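{- Let $G=(V,E)$ be a graph satisfying the standing assumptions, with derived graph $\bar G=(\bar V,\bar E)$ defined below. Let $u\in V$ with $\tau(u)=3$ and let $(u_i)_{i\ge1}$ be an occurrence of $\min_u$ starting at $u$. Let $L=\{k\ge1:\tau(u_k)=3\}$ and, for $i\ge1$, let $j_i$ be the $i$-th smallest element of $L$ if it exists. Define $u'_i=u_{j_i}$ whenever $j_i$ is defined, and $u'_i=u'_{|L|}$ whenever $j_i$ is not defined (i.e. $L$ is finite and $i>|L|$). Then $(\bar u'_i)_{i\ge1}$ is an occurrence of $\min_{\bar u}$ starting at $\bar u$ in $\bar G$.
   Context: Standing assumptions: $\Sigma$ is a finite alphabet with a total order $\preceq$; $G=(V,E)$ is finite, $E\subseteq V\times V\times\Sigma$, every node has an incoming edge, all edges entering a node $u$ have the same label $\lambda(u)$ (edges are written $(u,v)$), and $G$ is deterministic. Strings in $\Sigma^\omega$ are ordered lexicographically; $\alpha[i,j]=\alpha[i]\cdots\alpha[j]$. An occurrence of $\alpha\in\Sigma^\omega$ starting at $u$ is a sequence $(u_i)_{i\ge1}$ with $u_1=u$, $(u_{i+1},u_i)\in E$, $\lambda(u_i)=\alpha[i]$; $\min_u$ is the lexicographically smallest string with an occurrence starting at $u$. For $\alpha=a\alpha'$: $\tau(\alpha)=1$ if $\alpha'\prec\alpha$, $2$ if $\alpha'=\alpha$, $3$ if $\alpha\prec\alpha'$; $\tau(u):=\tau(\min_u)$. For $\tau(u)=3$, $\ell_u$ is the smallest $k\ge2$ with $\tau(u_k)\ge2$ for an (any)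 occurrence $(u_i)$ of $\min_u$ starting at $u$. For nonempty $R\subseteq V$, $R'=\arg\min_{v\in R}\lambda(v)$, $\mathtt{F}(R)=\arg\min_{v\in R'}\tau(v)$. $G_1(u)=\{u\}$ and for $1<i\le\ell_u$, $G_i(u)=\mathtt{F}(\{v':\exists v\in G_{i-1}(u),(v',v)\in E\})\setminus\bigcup_{j=2}^{i-1}G_j(u)$. $\gamma_u=\min_u[1,\ell_u]$, $\mathtt{t}_u\in\{2,3\}$ is the common $\tau$-value of the nodes of $G_{\ell_u}(u)$. $\Sigma'=\{(\gamma_u,\mathtt{t}_u):\tau(u)=3\}$ with total order $\preceq'$: for distinct pairs, $(\alpha,x)\prec'(\beta,y)$ iff $\alpha$ is not a prefix of $\beta$ and $\alpha\prec\beta$, or $\alpha=\beta,x=2,y=3$, or $\beta$ is a strict prefix of $\alpha$. The derived graph $\bar G$ has nodes $\bar V=\{\bar u:\tau(u)=3\}$, labels $\lambda(\bar u)=(\gamma_u,\mathtt{t}_u)$, edges $\bar E=\{(\bar v,\bar v):\mathtt{t}_v=2\}\cup\{(\bar u,\bar v):\mathtt{t}_v=3,u\in G_{\ell_v}(v)\}$; occurrences and minima in $\bar G$ are defined as in $G$, using the lexicographic extension of $\preceq'$ to $(\Sigma')^\omega$. -}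

module Defs where

open import Level using (Level)
open import Data.Nat using (ℕ; zero; suc; _<_; _≤_; _∸_)
open import Data.Fin as Fin using (Fin)
open import Data.Bool using (Bool; true)
open import Data.List using (List; []; _∷_; _++_; applyUpTo)
open import Data.Product using (Σ; ∃; ∃-syntax; _×_; _,_; proj₁; proj₂)
open import Data.Sum using (_⊎_)
open import Data.Empty using (⊥)
open import Relation.Nullary using (¬_; yes; no)
open import Relation.Binary.PropositionalEquality using (_≡_)
import Data.Nat as ℕ

-- Infinite strings (0-indexed: α 0 is the paper's α[1])

Stream : Set → Set
Stream A = ℕ → A

tail : {A : Set} → Stream A → Stream A
tail α i = α (suc i)

_≈S_ : {A : Set} → Stream A → Stream A → Set
α ≈S β = ∀ i → α i ≡ β i

LexLt : {A : Set} → (A → A → Set) → Stream A → Stream A → Set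
LexLt _<ₐ_ α β = ∃[ k ] ((∀ i → i < k → α i ≡ β i) × (α k <ₐ β k))

LexLe : {A : Set} → (A → A → Set) → Stream A → Stream A → Set
LexLe _<ₐ_ α β = LexLt _<ₐ_ α β ⊎ (α ≈S β)

-- Occurrences and minima in a labelled graph, generic in node type N,
-- label type A, edge relation Edge (Edge x y means (x,y) ∈ E), labelling lab.
-- seq 0 is the paper's u_1.

Occ : {N A : Set} → (N → N → Set) → (N → A) → N → Stream N → Stream A → Set
Occ Edge lab u seq α =
  (seq 0 ≡ u) × (∀ i → Edge (seq (suc i)) (seq i)) × (∀ i → lab (seq i) ≡ α i)

IsMin : {N A : Set} → (A → A → Set) → (N → N → Set) → (N → A) → N → Stream A → Set
IsMin _<ₐ_ Edge lab u α =
  (∃[ seq ] Occ Edge lab u seq α) ×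
  (∀ (β : Stream _) (seq : Stream _) → Occ Edge lab u seq β → LexLe _<ₐ_ α β)

record Graph (σ n : ℕ) : Set where
  field
    E   : Fin n → Fin n → Bool
    lab : Fin n → Fin σ                 -- λ(y): label of all edges entering y
    incoming      : ∀ u → ∃[ v ] (E v u ≡ true)
    deterministic : ∀ u v w → E u v ≡ true → E u w ≡ true → lab v ≡ lab w → v ≡ w

  Edge : Fin n → Fin n → Set
  Edge x y = E x y ≡ true

_<Σ_ : {σ : ℕ} → Fin σ → Fin σ → Set
_<Σ_ = Fin._<_

TauIs : {σ : ℕ} → Stream (Fin σ) → ℕ → Set
TauIs α 1 = LexLt _<Σ_ (tail α) α
TauIs α 2 = tail α ≈S α
TauIs α 3 = LexLt _<Σ_ α (tail α)
TauIs α _ = ⊥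

module _ {σ n : ℕ} (G : Graph σ n) (t : Fin n → ℕ) where
  open Graph G

  Pred : (Fin n → Set) → Fin n → Set
  Pred S v' = ∃[ v ] (S v × Edge v' v)

  F : (Fin n → Set) → Fin n → Set
  F R v = R v × (∀ w → R w → lab v Fin.≤ lab w)
             × (∀ w → R w → lab w ≡ lab v → t v ℕ.≤ t w)

  -- Gstep u i = (G_{i+1}(u) , ⋃_{j=2}^{i+1} G_j(u))
  Gstep : Fin n → ℕ → (Fin n → Set) × (Fin n → Set)
  Gstep u zero = (λ v → v ≡ u) , (λ _ → ⊥)
  Gstep u (suc i) =
    let g = proj₁ (Gstep u i)
        U = proj₂ (Gstep u i)
        g' = λ v → F (Pred g) v × ¬ U v
    in g' , (λ v → U v ⊎ g' v)

  -- Gset i u = G_i(u)  (i ≥ 1; G_0 is empty and unused)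
  Gset : ℕ → Fin n → Fin n → Set
  Gset zero u v = ⊥
  Gset (suc i) u v = proj₁ (Gstep u i) v

record Quantities {σ n : ℕ} (G : Graph σ n) : Set₁ where
  open Graph G
  field
    mn     : Fin n → Stream (Fin σ)
    mnSpec : ∀ u → IsMin _<Σ_ Edge lab u (mn u)
    τ      : Fin n → ℕ
    τSpec  : ∀ u → TauIs (mn u) (τ u)
    ℓ      : Fin n → ℕ                             -- ℓ_u (1-indexed position)
    ℓSpec  : ∀ u → τ u ≡ 3 → ∀ seq → Occ Edge lab u seq (mn u) →
               (2 ≤ ℓ u) × (2 ≤ τ (seq (ℓ u ∸ 1))) ×
               (∀ k → 2 ≤ k → k < ℓ u → τ (seq (k ∸ 1)) < 2)
    tt     : Fin n → ℕ
    ttSpec : ∀ u → τ u ≡ 3 →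
               (tt u ≡ 2 ⊎ tt u ≡ 3) ×
               (∀ v → Gset G τ (ℓ u) u v → τ v ≡ tt u)

data _<L_ {σ : ℕ} : List (Fin σ) → List (Fin σ) → Set where
  nil<  : ∀ {b β} → [] <L (b ∷ β)
  here  : ∀ {a b α β} → a Fin.< b → (a ∷ α) <L (b ∷ β)
  there : ∀ {a α β} → α <L β → (a ∷ α) <L (a ∷ β)

IsPrefix : {A : Set} → List A → List A → Set
IsPrefix α β = ∃[ γ ] (α ++ γ ≡ β)

IsStrictPrefix : {A : Set} → List A → List A → Set
IsStrictPrefix α β = ∃[ c ] ∃[ γ ] (α ++ (c ∷ γ) ≡ β)

_<'_ : {σ : ℕ} → List (Fin σ) × ℕ → List (Fin σ) × ℕ → Set
(α , x) <' (β , y) =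
  ¬ ((α , x) ≡ (β , y)) ×
  ( (¬ IsPrefix α β × α <L β)
  ⊎ (α ≡ β × x ≡ 2 × y ≡ 3)
  ⊎ IsStrictPrefix β α )

-- The derived graph Ḡ, realised on the node set V restricted to τ = 3
-- (node ū is represented by u; edges only join nodes with τ = 3).

module Derived {σ n : ℕ} {G : Graph σ n} (Q : Quantities G) where
  open Graph G
  open Quantities Q

  γ : Fin n → List (Fin σ)
  γ u = applyUpTo (mn u) (ℓ u)

  labBar : Fin n → List (Fin σ) × ℕ
  labBar u = γ u , tt u

  EdgeBar : Fin n → Fin n → Set
  EdgeBar u v =
    (τ v ≡ 3 × tt v ≡ 2 × u ≡ v)
    ⊎ (τ v ≡ 3 × tt v ≡ 3 × τ u ≡ 3 × Gset G τ (ℓ v) v u)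

module Compressed {σ n : ℕ} {G : Graph σ n} (Q : Quantities G) (seq : Stream (Fin n)) where
  open Quantities Q

  InL : ℕ → Set
  InL k = τ (seq k) ≡ 3

  count : ℕ → ℕ
  count zero = zero
  count (suc k) with τ (seq k) ℕ.≟ 3
  ... | yes _ = suc (count k)
  ... | no  _ = count k

  -- j_i is defined (0-indexed i) and equals k
  IsJ : ℕ → ℕ → Set
  IsJ i k = InL k × count k ≡ i

  PrimeSpec : Stream (Fin n) → Set
  PrimeSpec u' =
    (∀ i k → IsJ i k → u' i ≡ seq k) ×
    (∀ i → ¬ (∃[ k ] IsJ i k) →
       ∀ m → (∃[ k ] IsJ m k) → ¬ (∃[ k ] IsJ (suc m) k) → u' i ≡ u' m)

module Submission where

-- Along an occurrence of min_v with τ(v) = 3, the node at position i lies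
-- in G_i(v) for i ≤ ℓ_v, and every node of G_i(v) is reached by a path
-- spelling min_v[1, i]; this follows inductively from the fact that
-- suffixes of a minimum are minima, while τ = 1 on the interior of the
-- block makes its suffixes strictly decrease, so no node is revisited.
-- Hence the occurrence of min_u cuts into blocks γ, each ending in G_ℓ of
-- its first node, and t decides whether the next block starts there
-- (t = 3) or min_u is constant from there on (t = 2): this is the
-- occurrence (ū'_i) of ū in Ḡ.  Conversely, any occurrence (w_i) in Ḡ
-- unfolds block by block into an occurrence in G of some β, and
-- min_u ≤ β compared block by block gives λ(ū'_i) ≤' λ(w_i); the first
-- position where min_u and β differ bounds how many blocks must be compared.

open import Defs
open import Data.Nat using (ℕ; zero; suc; _+_; _∸_; _≤_; _<_; z≤n; s≤s; _≟_; _<?_; _≤?_)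
open import Data.Fin using (Fin)
open import Data.Product using (_×_; ∃-syntax; _,_; proj₁; proj₂)
open import Relation.Binary.PropositionalEquality
  using (_≡_; refl; sym; trans; cong; cong₂; subst; subst₂; module ≡-Reasoning)
open import Function using (_∘_)

import Data.Nat.Properties as ℕₚ
import Data.Fin as F
import Data.Fin.Properties as Fₚ
open import Data.List using ([]; _∷_; applyUpTo; length)
import Data.List.Properties as Listₚ
open import Data.Sum using (_⊎_; inj₁; inj₂; [_,_]′)
open import Data.Empty using (⊥; ⊥-elim)
open import Relation.Nullary using (¬_; yes; no; Dec)
open import Relation.Nullary.Decidable using (_×-dec_)
open import Relation.Binary.Definitions using (Irreflexive; Transitive; Tri; tri<; tri≈; tri>)

module _ {A : Set} where

  infixr 5 _∷ₛ_

  _∷ₛ_ : A → Stream A → Stream A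
  (a ∷ₛ α) zero = a
  (a ∷ₛ α) (suc i) = α i

  drop : ℕ → Stream A → Stream A
  drop k α i = α (i + k)

  glue : ℕ → Stream A → Stream A → Stream A
  glue zero α β = β
  glue (suc j) α β = α 0 ∷ₛ glue j (tail α) β

  glue-< : ∀ j α β {k} → k < j → glue j α β k ≡ α k
  glue-< (suc j) α β {zero} _ = refl
  glue-< (suc j) α β {suc k} (s≤s k<j) = glue-< j (tail α) β k<j

  glue-+ : ∀ j α β i → glue j α β (j + i) ≡ β i
  glue-+ zero α β i = refl
  glue-+ (suc j) α β i = glue-+ j (tail α) β i

  drop-glue : ∀ j α β → drop j (glue j α β) ≈S β
  drop-glue j α β i = trans (cong (glue j α β) (ℕₚ.+-comm i j)) (glue-+ j α β i)

  ≈S-sym : ∀ {α β : Stream A} → α ≈S β → β ≈S α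
  ≈S-sym α≈β i = sym (α≈β i)

  ≈S-trans : ∀ {α β γ : Stream A} → α ≈S β → β ≈S γ → α ≈S γ
  ≈S-trans α≈β β≈γ i = trans (α≈β i) (β≈γ i)

module Lex {A : Set} (_≺_ : A → A → Set) where

  infix 4 _<ₗ_ _≤ₗ_

  _<ₗ_ : Stream A → Stream A → Set
  _<ₗ_ = LexLt _≺_

  _≤ₗ_ : Stream A → Stream A → Set
  _≤ₗ_ = LexLe _≺_

  <ₗ-respʳ-≈ : ∀ {α β γ} → α <ₗ β → β ≈S γ → α <ₗ γ
  <ₗ-respʳ-≈ {α} (k , agree , α<β) β≈γ =
    k , (λ i i<k → trans (agree i i<k) (β≈γ i)) , subst (α k ≺_) (β≈γ k) α<β

  <ₗ-respˡ-≈ : ∀ {α β γ} → α ≈S β → α <ₗ γ → β <ₗ γ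
  <ₗ-respˡ-≈ {γ = γ} α≈β (k , agree , α<γ) =
    k , (λ i i<k → trans (sym (α≈β i)) (agree i i<k)) , subst (_≺ γ k) (α≈β k) α<γ

  ≤ₗ-respʳ-≈ : ∀ {α β γ} → α ≤ₗ β → β ≈S γ → α ≤ₗ γ
  ≤ₗ-respʳ-≈ (inj₁ α<β) β≈γ = inj₁ (<ₗ-respʳ-≈ α<β β≈γ)
  ≤ₗ-respʳ-≈ (inj₂ α≈β) β≈γ = inj₂ (≈S-trans α≈β β≈γ)

  ≤ₗ-respˡ-≈ : ∀ {α β γ} → α ≈S β → α ≤ₗ γ → β ≤ₗ γ
  ≤ₗ-respˡ-≈ α≈β (inj₁ α<γ) = inj₁ (<ₗ-respˡ-≈ α≈β α<γ)
  ≤ₗ-respˡ-≈ α≈β (inj₂ α≈γ) = inj₂ (≈S-trans (≈S-sym α≈β) α≈γ)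

  ≤ₗ-head : ∀ {α β} → α ≤ₗ β → α 0 ≺ β 0 ⊎ α 0 ≡ β 0
  ≤ₗ-head (inj₁ (zero , _ , α<β)) = inj₁ α<β
  ≤ₗ-head (inj₁ (suc k , agree , _)) = inj₂ (agree 0 (s≤s z≤n))
  ≤ₗ-head (inj₂ α≈β) = inj₂ (α≈β 0)

  module Strict (≺-irrefl : Irreflexive _≡_ _≺_) (≺-trans : Transitive _≺_) where

    <ₗ-irrefl : ∀ {α β} → α ≈S β → ¬ α <ₗ β
    <ₗ-irrefl α≈β (k , _ , α<β) = ≺-irrefl (α≈β k) α<β

    <ₗ-irrefl′ : ∀ {α} → ¬ α <ₗ α
    <ₗ-irrefl′ = <ₗ-irrefl (λ _ → refl)

    <ₗ-trans : ∀ {α β γ} → α <ₗ β → β <ₗ γ → α <ₗ γ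
    <ₗ-trans {α} {β} {γ} (k , agree , α<β) (k′ , agree′ , β<γ) with ℕₚ.<-cmp k k′
    ... | tri< k<k′ _ _ =
      k , (λ i i<k → trans (agree i i<k) (agree′ i (ℕₚ.<-trans i<k k<k′))) ,
      subst (α k ≺_) (agree′ k k<k′) α<β
    ... | tri≈ _ refl _ = k , (λ i i<k → trans (agree i i<k) (agree′ i i<k)) , ≺-trans α<β β<γ
    ... | tri> _ _ k′<k =
      k′ , (λ i i<k′ → trans (agree i (ℕₚ.<-trans i<k′ k′<k)) (agree′ i i<k′)) ,
      subst (_≺ γ k′) (sym (agree k′ k′<k)) β<γ

    <-≤ₗ-trans : ∀ {α β γ} → α <ₗ β → β ≤ₗ γ → α <ₗ γ
    <-≤ₗ-trans α<β (inj₁ β<γ) = <ₗ-trans α<β β<γ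
    <-≤ₗ-trans α<β (inj₂ β≈γ) = <ₗ-respʳ-≈ α<β β≈γ

    ≤-<ₗ-trans : ∀ {α β γ} → α ≤ₗ β → β <ₗ γ → α <ₗ γ
    ≤-<ₗ-trans (inj₁ α<β) β<γ = <ₗ-trans α<β β<γ
    ≤-<ₗ-trans (inj₂ α≈β) β<γ = <ₗ-respˡ-≈ (≈S-sym α≈β) β<γ

    ≤ₗ-trans : ∀ {α β γ} → α ≤ₗ β → β ≤ₗ γ → α ≤ₗ γ
    ≤ₗ-trans (inj₁ α<β) β≤γ = inj₁ (<-≤ₗ-trans α<β β≤γ)
    ≤ₗ-trans (inj₂ α≈β) β≤γ = ≤ₗ-respˡ-≈ (≈S-sym α≈β) β≤γ

    ≤ₗ-antisym : ∀ {α β} → α ≤ₗ β → β ≤ₗ α → α ≈S β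
    ≤ₗ-antisym (inj₂ α≈β) _ = α≈β
    ≤ₗ-antisym (inj₁ α<β) β≤α = ⊥-elim (<ₗ-irrefl′ (<-≤ₗ-trans α<β β≤α))

    drop-<ₗ : ∀ {α β} j → (∀ i → i < j → α i ≡ β i) → α <ₗ β → drop j α <ₗ drop j β
    drop-<ₗ {α} {β} j agree-j (k , agree , α<β) with j ≤? k
    ... | yes j≤k =
      k ∸ j , (λ i i<k∸j → agree (i + j) (shift i<k∸j)) ,
      subst (λ m → α m ≺ β m) (sym (ℕₚ.m∸n+n≡m j≤k)) α<β
      where
      shift : ∀ {i} → i < k ∸ j → i + j < k
      shift {i} i<k∸j = subst (i + j <_) (ℕₚ.m∸n+n≡m j≤k) (ℕₚ.+-monoˡ-< j i<k∸j)
    ... | no j≰k = ⊥-elim (≺-irrefl (agree-j k (ℕₚ.≰⇒> j≰k)) α<β)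

    drop-≤ₗ : ∀ {α β} j → (∀ i → i < j → α i ≡ β i) → α ≤ₗ β → drop j α ≤ₗ drop j β
    drop-≤ₗ j agree-j (inj₁ α<β) = inj₁ (drop-<ₗ j agree-j α<β)
    drop-≤ₗ j agree-j (inj₂ α≈β) = inj₂ (λ i → α≈β (i + j))

module _ {σ : ℕ} where
  open Lex (_<Σ_ {σ}) public
  open Strict Fₚ.<-irrefl Fₚ.<-trans public

module _ {σ : ℕ} where

  repeatHead : Stream (Fin σ) → Stream (Fin σ)
  repeatHead α _ = α 0

  -- τ(α) compares α with its tail; equivalently with the constant string
  -- on its first letter, since both comparisons are decided at the first
  -- position where α is not constant.
  TauHead : Stream (Fin σ) → ℕ → Set
  TauHead α 1 = α <ₗ repeatHead α
  TauHead α 2 = α ≈S repeatHead α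
  TauHead α 3 = repeatHead α <ₗ α
  TauHead α _ = ⊥

  private
    constant-prefix : ∀ (α : Stream (Fin σ)) k → (∀ i → i < k → α (suc i) ≡ α i) →
                      ∀ i → i ≤ k → α i ≡ α 0
    constant-prefix α k step zero _ = refl
    constant-prefix α k step (suc i) i<k = trans (step i i<k) (constant-prefix α k step i (ℕₚ.<⇒≤ i<k))

  TauIs⇒TauHead : ∀ {α} t → TauIs α t → TauHead α t
  TauIs⇒TauHead {α} 1 (k , agree , α′<α) =
    suc k , (λ i i≤k → constant-prefix α k agree i (ℕₚ.≤-pred i≤k)) ,
    subst (α (suc k) F.<_) (constant-prefix α k agree k ℕₚ.≤-refl) α′<α
  TauIs⇒TauHead {α} 2 α′≈α i = constant-prefix α i (λ j _ → α′≈α j) i ℕₚ.≤-refl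
  TauIs⇒TauHead {α} 3 (k , agree , α<α′) =
    suc k , (λ i i≤k → sym (constant-prefix α k agree′ i (ℕₚ.≤-pred i≤k))) ,
    subst (F._< α (suc k)) (constant-prefix α k agree′ k ℕₚ.≤-refl) α<α′
    where
    agree′ : ∀ i → i < k → α (suc i) ≡ α i
    agree′ i i<k = sym (agree i i<k)

  TauHead-resp-≈ : ∀ {α β} t → α ≈S β → TauHead α t → TauHead β t
  TauHead-resp-≈ 1 α≈β α<α₀ = <ₗ-respʳ-≈ (<ₗ-respˡ-≈ α≈β α<α₀) (λ _ → α≈β 0)
  TauHead-resp-≈ 2 α≈β α≈α₀ = ≈S-trans (≈S-sym α≈β) (≈S-trans α≈α₀ (λ _ → α≈β 0))
  TauHead-resp-≈ 3 α≈β α₀<α = <ₗ-respʳ-≈ (<ₗ-respˡ-≈ (λ _ → α≈β 0) α₀<α) α≈β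

  TauHead-range : ∀ {α} t → TauHead α t → t ≡ 1 ⊎ t ≡ 2 ⊎ t ≡ 3
  TauHead-range 1 _ = inj₁ refl
  TauHead-range 2 _ = inj₂ (inj₁ refl)
  TauHead-range 3 _ = inj₂ (inj₂ refl)

  TauHead-functional : ∀ {α} t t′ → TauHead α t → TauHead α t′ → t ≡ t′
  TauHead-functional 1 1 _ _ = refl
  TauHead-functional 2 2 _ _ = refl
  TauHead-functional 3 3 _ _ = refl
  TauHead-functional 1 2 α<α₀ α≈α₀ = ⊥-elim (<ₗ-irrefl α≈α₀ α<α₀)
  TauHead-functional 1 3 α<α₀ α₀<α = ⊥-elim (<ₗ-irrefl′ (<ₗ-trans α<α₀ α₀<α))
  TauHead-functional 2 1 α≈α₀ α<α₀ = ⊥-elim (<ₗ-irrefl α≈α₀ α<α₀)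
  TauHead-functional 2 3 α≈α₀ α₀<α = ⊥-elim (<ₗ-irrefl (≈S-sym α≈α₀) α₀<α)
  TauHead-functional 3 1 α₀<α α<α₀ = ⊥-elim (<ₗ-irrefl′ (<ₗ-trans α<α₀ α₀<α))
  TauHead-functional 3 2 α₀<α α≈α₀ = ⊥-elim (<ₗ-irrefl (≈S-sym α≈α₀) α₀<α)
  TauHead-functional 1 (suc (suc (suc (suc _)))) _ ()
  TauHead-functional 2 (suc (suc (suc (suc _)))) _ ()
  TauHead-functional 3 (suc (suc (suc (suc _)))) _ ()

  repeatHead-≤ₗ : ∀ {α} t → 2 ≤ t → TauHead α t → repeatHead α ≤ₗ α
  repeatHead-≤ₗ 1 (s≤s ()) _
  repeatHead-≤ₗ 2 _ α≈α₀ = inj₂ (≈S-sym α≈α₀)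
  repeatHead-≤ₗ 3 _ α₀<α = inj₁ α₀<α

  TauHead-2-≈ : ∀ {α β} → α 0 ≡ β 0 → TauHead α 2 → TauHead β 2 → α ≈S β
  TauHead-2-≈ α₀≡β₀ α≈α₀ β≈β₀ i = trans (α≈α₀ i) (trans α₀≡β₀ (sym (β≈β₀ i)))

  TauHead-2-drop : ∀ {α j e} → TauHead (drop j α) 2 → j ≤ e → TauHead (drop e α) 2
  TauHead-2-drop {α} {j} {e} constant j≤e i =
    trans (from-j (i + e) (ℕₚ.≤-trans j≤e (ℕₚ.m≤n+m e i))) (sym (from-j e j≤e))
    where
    from-j : ∀ k → j ≤ k → α k ≡ α j
    from-j k j≤k = trans (cong α (sym (ℕₚ.m∸n+n≡m j≤k))) (constant (k ∸ j))

  TauHead-mono : ∀ {α β} t t′ → α ≤ₗ β → α 0 ≡ β 0 → 2 ≤ t →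
                 TauHead α t → TauHead β t′ → t ≤ t′
  TauHead-mono 1 _ _ _ (s≤s ()) _ _
  TauHead-mono t 1 α≤β α₀≡β₀ 2≤t α-t β<β₀ =
    ⊥-elim (<ₗ-irrefl′ (<-≤ₗ-trans β<β₀ (≤ₗ-trans (inj₂ (λ _ → sym α₀≡β₀))
                                                  (≤ₗ-trans (repeatHead-≤ₗ t 2≤t α-t) α≤β))))
  TauHead-mono 2 2 _ _ _ _ _ = ℕₚ.≤-refl
  TauHead-mono 2 3 _ _ _ _ _ = s≤s (s≤s z≤n)
  TauHead-mono 3 2 α≤β α₀≡β₀ _ α₀<α β≈β₀ =
    ⊥-elim (<ₗ-irrefl′ (<-≤ₗ-trans α₀<α (≤ₗ-respʳ-≈ α≤β (≈S-trans β≈β₀ λ _ → sym α₀≡β₀))))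
  TauHead-mono 3 3 _ _ _ _ _ = ℕₚ.≤-refl

module Paths {N A : Set} (Edge : N → N → Set) (lab : N → A) where

  -- Like occurrences, paths follow edges backwards: Path u α j w goes from
  -- u to w through j edges and spells α[0, j).
  data Path : N → Stream A → ℕ → N → Set where
    [] : ∀ {u α} → Path u α 0 u
    step : ∀ {u v w α j} → lab u ≡ α 0 → Edge v u → Path v (tail α) j w → Path u α (suc j) w

  occ-tail : ∀ {u s α} → Occ Edge lab u s α → Occ Edge lab (s 1) (tail s) (tail α)
  occ-tail (_ , edge , label) = refl , (λ i → edge (suc i)) , (λ i → label (suc i))

  occ-drop : ∀ {u s α} → Occ Edge lab u s α → ∀ k → Occ Edge lab (s k) (drop k s) (drop k α)
  occ-drop (_ , edge , label) k = refl , (λ i → edge (i + k)) , (λ i → label (i + k))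

  occ⇒Path : ∀ {u s α} → Occ Edge lab u s α → ∀ j → Path u α j (s j)
  occ⇒Path (refl , _ , _) zero = []
  occ⇒Path o@(refl , edge , label) (suc j) = step (label 0) (edge 0) (occ⇒Path (occ-tail o) j)

  Path-snoc : ∀ {u w w′ α j} → Path u α j w → lab w ≡ α j → Edge w′ w → Path u α (suc j) w′
  Path-snoc [] label edge = step label edge []
  Path-snoc (step label₀ edge₀ p) label edge = step label₀ edge₀ (Path-snoc p label edge)

  Path-resp : ∀ {u w α β j} → (∀ k → k < j → α k ≡ β k) → Path u α j w → Path u β j w
  Path-resp agree [] = []
  Path-resp agree (step label edge p) =
    step (trans label (agree 0 (s≤s z≤n))) edge (Path-resp (λ k k<j → agree (suc k) (s≤s k<j)) p)

  nodes : ∀ {u w α j} → Path u α j w → Stream N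
  nodes {u} [] = λ _ → u
  nodes {u} (step _ _ p) = u ∷ₛ nodes p

  nodes-start : ∀ {u w α j} (p : Path u α j w) → nodes p 0 ≡ u
  nodes-start [] = refl
  nodes-start (step _ _ _) = refl

  nodes-end : ∀ {u w α j} (p : Path u α j w) → nodes p j ≡ w
  nodes-end [] = refl
  nodes-end (step _ _ p) = nodes-end p

  nodes-edge : ∀ {u w α j} (p : Path u α j w) → ∀ k → k < j → Edge (nodes p (suc k)) (nodes p k)
  nodes-edge (step _ edge p) zero _ = subst (λ v → Edge v _) (sym (nodes-start p)) edge
  nodes-edge (step _ _ p) (suc k) (s≤s k<j) = nodes-edge p k k<j

  nodes-label : ∀ {u w α j} (p : Path u α j w) → ∀ k → k < j → lab (nodes p k) ≡ α k
  nodes-label (step label _ _) zero _ = label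
  nodes-label (step _ _ p) (suc k) (s≤s k<j) = nodes-label p k k<j

  Path-++-occ : ∀ {u w α β j s} → Path u α j w → Occ Edge lab w s β → ∃[ s′ ] Occ Edge lab u s′ (glue j α β)
  Path-++-occ [] o = _ , o
  Path-++-occ {u} {α = α} {β} {suc j} (step label edge p) o with Path-++-occ p o
  ... | s′ , refl , edge′ , label′ = u ∷ₛ s′ , refl , edges , labels
    where
    edges : ∀ i → Edge ((u ∷ₛ s′) (suc i)) ((u ∷ₛ s′) i)
    edges zero = edge
    edges (suc i) = edge′ i
    labels : ∀ i → lab ((u ∷ₛ s′) i) ≡ glue (suc j) α β i
    labels zero = label
    labels (suc i) = label′ i

-- Block i either ends after len i edges where block i+1 starts, or (when
-- not Finite i) goes on forever; concat runs through the blocks in turn.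
module Concatenation {N : Set} (Edge : N → N → Set) (blk : ℕ → Stream N) (len : ℕ → ℕ)
  {Finite : ℕ → Set} (finite? : ∀ i → Dec (Finite i)) (len-pos : ∀ i → Finite i → 1 ≤ len i)
  (blk-edge : ∀ i k → (Finite i → k < len i) → Edge (blk i (suc k)) (blk i k))
  (blk-link : ∀ i → Finite i → blk (suc i) 0 ≡ blk i (len i)) where

  Valid : ℕ × ℕ → Set
  Valid (i , d) = Finite i → d < len i

  Crosses : ℕ × ℕ → Set
  Crosses (i , d) = Finite i × suc d ≡ len i

  next-by : ∀ p → Dec (Crosses p) → ℕ × ℕ
  next-by (i , d) (yes _) = suc i , 0
  next-by (i , d) (no _) = i , suc d

  next : ℕ × ℕ → ℕ × ℕ
  next (i , d) = next-by (i , d) (finite? i ×-dec (suc d ≟ len i))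

  next-valid : ∀ p → Valid p → Valid (next p)
  next-valid (i , d) valid = by (finite? i ×-dec (suc d ≟ len i))
    where
    by : (c : Dec (Crosses (i , d))) → Valid (next-by (i , d) c)
    by (yes _) = len-pos (suc i)
    by (no ¬crosses) fin = ℕₚ.≤∧≢⇒< (valid fin) (λ eq → ¬crosses (fin , eq))

  next-edge : ∀ p → Valid p → Edge (blk (proj₁ (next p)) (proj₂ (next p))) (blk (proj₁ p) (proj₂ p))
  next-edge (i , d) valid = by (finite? i ×-dec (suc d ≟ len i))
    where
    by : (c : Dec (Crosses (i , d))) → let (i′ , d′) = next-by (i , d) c in Edge (blk i′ d′) (blk i d)
    by (yes (fin , eq)) =
      subst (λ v → Edge v (blk i d)) (sym (trans (blk-link i fin) (cong (blk i) (sym eq)))) (blk-edge i d valid)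
    by (no _) = blk-edge i d valid

  next-inside : ∀ i d → (Finite i → suc d < len i) → next (i , d) ≡ (i , suc d)
  next-inside i d inside = by (finite? i ×-dec (suc d ≟ len i))
    where
    by : (c : Dec (Crosses (i , d))) → next-by (i , d) c ≡ (i , suc d)
    by (yes (fin , eq)) = ⊥-elim (ℕₚ.<⇒≢ (inside fin) eq)
    by (no _) = refl

  next-last : ∀ i d → Finite i → suc d ≡ len i → next (i , d) ≡ (suc i , 0)
  next-last i d fin eq = by (finite? i ×-dec (suc d ≟ len i))
    where
    by : (c : Dec (Crosses (i , d))) → next-by (i , d) c ≡ (suc i , 0)
    by (yes _) = refl
    by (no ¬crosses) = ⊥-elim (¬crosses (fin , eq))

  locate : ℕ → ℕ × ℕ
  locate zero = 0 , 0
  locate (suc k) = next (locate k)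

  locate-valid : ∀ k → Valid (locate k)
  locate-valid zero fin = len-pos 0 fin
  locate-valid (suc k) = next-valid (locate k) (locate-valid k)

  concat : Stream N
  concat k = blk (proj₁ (locate k)) (proj₂ (locate k))

  concat-edge : ∀ k → Edge (concat (suc k)) (concat k)
  concat-edge k = next-edge (locate k) (locate-valid k)

  start : ℕ → ℕ
  start zero = 0
  start (suc i) = len i + start i

  start-< : ∀ i → Finite i → start i < start (suc i)
  start-< i fin = ℕₚ.+-monoˡ-≤ (start i) (len-pos i fin)

  AllFinite : ℕ → Set
  AllFinite i = ∀ j → j < i → Finite j

  locate-inside : ∀ i → locate (start i) ≡ (i , 0) →
                  ∀ d → (Finite i → d < len i) → locate (d + start i) ≡ (i , d)
  locate-inside i at-start zero _ = at-start
  locate-inside i at-start (suc d) inside =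
    trans (cong next (locate-inside i at-start d (λ fin → ℕₚ.<⇒≤ (inside fin)))) (next-inside i d inside)

  locate-next : ∀ i → locate (start i) ≡ (i , 0) → Finite i → locate (start (suc i)) ≡ (suc i , 0)
  locate-next i at-start fin =
    trans (cong (λ d → locate (d + start i)) (sym suc-pred))
          (trans (cong next (locate-inside i at-start (len i ∸ 1) (λ _ → ℕₚ.≤-reflexive suc-pred)))
                 (next-last i (len i ∸ 1) fin suc-pred))
    where
    suc-pred : suc (len i ∸ 1) ≡ len i
    suc-pred = ℕₚ.m+[n∸m]≡n (len-pos i fin)

  locate-start : ∀ i → AllFinite i → locate (start i) ≡ (i , 0)
  locate-start zero _ = refl
  locate-start (suc i) finite =
    locate-next i (locate-start i (λ j j<i → finite j (ℕₚ.m<n⇒m<1+n j<i))) (finite i ℕₚ.≤-refl)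

  concat-block : ∀ i → AllFinite i → ∀ d → (Finite i → d ≤ len i) → concat (d + start i) ≡ blk i d
  concat-block i finite d d≤len with finite? i
  ... | no ¬fin =
    cong (λ (i′ , d′) → blk i′ d′) (locate-inside i (locate-start i finite) d (λ fin → ⊥-elim (¬fin fin)))
  ... | yes fin with ℕₚ.m≤n⇒m<n∨m≡n (d≤len fin)
  ...   | inj₁ d<len = cong (λ (i′ , d′) → blk i′ d′) (locate-inside i (locate-start i finite) d (λ _ → d<len))
  ...   | inj₂ refl =
    trans (cong (λ (i′ , d′) → blk i′ d′) (locate-next i (locate-start i finite) fin)) (blk-link i fin)

module _ {A : Set} where

  applyUpTo-cong : ∀ (f g : ℕ → A) n → (∀ d → d < n → f d ≡ g d) → applyUpTo f n ≡ applyUpTo g n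
  applyUpTo-cong f g zero agree = refl
  applyUpTo-cong f g (suc n) agree =
    cong₂ _∷_ (agree 0 (s≤s z≤n)) (applyUpTo-cong (f ∘ suc) (g ∘ suc) n (λ d d<n → agree (suc d) (s≤s d<n)))

  applyUpTo-injectiveˡ : ∀ (f g : ℕ → A) {m n} → applyUpTo f m ≡ applyUpTo g n → m ≡ n
  applyUpTo-injectiveˡ f g {m} {n} eq =
    trans (sym (Listₚ.length-applyUpTo f m)) (trans (cong length eq) (Listₚ.length-applyUpTo g n))

  applyUpTo-strict-prefix : ∀ (f g : ℕ → A) {m n} → n < m → (∀ d → d < n → f d ≡ g d) →
                            IsStrictPrefix (applyUpTo g n) (applyUpTo f m)
  applyUpTo-strict-prefix f g {suc m} {zero} _ _ = f 0 , applyUpTo (f ∘ suc) m , refl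
  applyUpTo-strict-prefix f g {suc m} {suc n} (s≤s n<m) agree
    with applyUpTo-strict-prefix (f ∘ suc) (g ∘ suc) n<m (λ d d<n → agree (suc d) (s≤s d<n))
  ... | c , γ , eq = c , γ , cong₂ _∷_ (sym (agree 0 (s≤s z≤n))) eq

applyUpTo-<L : ∀ {σ} (f g : ℕ → Fin σ) {P m n} → P < m → P < n → (∀ d → d < P → f d ≡ g d) →
               f P F.< g P → (applyUpTo f m <L applyUpTo g n) × ¬ IsPrefix (applyUpTo f m) (applyUpTo g n)
applyUpTo-<L f g {zero} {suc m} {suc n} _ _ _ lt =
  here lt , λ (_ , eq) → Fₚ.<-irrefl (Listₚ.∷-injectiveˡ eq) lt
applyUpTo-<L f g {suc P} {suc m} {suc n} (s≤s P<m) (s≤s P<n) agree lt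
  with applyUpTo-<L (f ∘ suc) (g ∘ suc) P<m P<n (λ d d<P → agree (suc d) (s≤s d<P)) lt
... | tail< , ¬prefix =
  subst (λ a → (f 0 ∷ applyUpTo (f ∘ suc) m) <L (a ∷ applyUpTo (g ∘ suc) n)) (agree 0 (s≤s z≤n)) (there tail<) ,
  λ (γ , eq) → ¬prefix (γ , Listₚ.∷-injectiveʳ eq)

module Minima {σ n : ℕ} (G : Graph σ n) (Q : Quantities G) where
  open Graph G
  open Quantities Q
  open Derived Q
  open Paths Edge lab public

  min-occ : ∀ v → ∃[ s ] Occ Edge lab v s (mn v)
  min-occ v = proj₁ (mnSpec v)

  min-≤ₗ : ∀ {v s β} → Occ Edge lab v s β → mn v ≤ₗ β
  min-≤ₗ {v} {s} {β} o = proj₂ (mnSpec v) β s o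

  lab≡min-head : ∀ v → lab v ≡ mn v 0
  lab≡min-head v with min-occ v
  ... | _ , refl , _ , label = label 0

  Path-min-≤ₗ : ∀ {v w j} → Path v (mn v) j w → drop j (mn v) ≤ₗ mn w
  Path-min-≤ₗ {v} {w} {j} p with Path-++-occ p (proj₂ (min-occ w))
  ... | _ , o = ≤ₗ-respʳ-≈ (drop-≤ₗ j agree (min-≤ₗ o)) (drop-glue j (mn v) (mn w))
    where
    agree : ∀ i → i < j → mn v i ≡ glue j (mn v) (mn w) i
    agree i i<j = sym (glue-< j (mn v) (mn w) i<j)

  min-suffix : ∀ {v s} → Occ Edge lab v s (mn v) → ∀ k → mn (s k) ≈S drop k (mn v)
  min-suffix o k = ≤ₗ-antisym (min-≤ₗ (occ-drop o k)) (Path-min-≤ₗ (occ⇒Path o k))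

  min-occ-suffix : ∀ {v s} → Occ Edge lab v s (mn v) → ∀ k → Occ Edge lab (s k) (drop k s) (mn (s k))
  min-occ-suffix o k with occ-drop o k
  ... | at-k , edge , label = at-k , edge , λ i → trans (label i) (sym (min-suffix o k i))

  TauHead-min : ∀ x → TauHead (mn x) (τ x)
  TauHead-min x = TauIs⇒TauHead (τ x) (τSpec x)

  TauHead-suffix : ∀ {v s} → Occ Edge lab v s (mn v) → ∀ k → TauHead (drop k (mn v)) (τ (s k))
  TauHead-suffix o k = TauHead-resp-≈ _ (min-suffix o k) (TauHead-min _)

  τ-range : ∀ x → τ x ≡ 1 ⊎ τ x ≡ 2 ⊎ τ x ≡ 3
  τ-range x = TauHead-range (τ x) (TauHead-min x)

  1≤τ : ∀ x → 1 ≤ τ x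
  1≤τ x with τ-range x
  ... | inj₁ τ≡1 = ℕₚ.≤-reflexive (sym τ≡1)
  ... | inj₂ (inj₁ τ≡2) = subst (1 ≤_) (sym τ≡2) (s≤s z≤n)
  ... | inj₂ (inj₂ τ≡3) = subst (1 ≤_) (sym τ≡3) (s≤s z≤n)

  module Block {v : Fin n} (τv≡3 : τ v ≡ 3) {s : Stream (Fin n)} (o : Occ Edge lab v s (mn v)) where

    -- the 0-indexed position of u_ℓ
    ℓ₀ : ℕ
    ℓ₀ = ℓ v ∸ 1

    private
      spec = ℓSpec v τv≡3 s o

    2≤ℓ : 2 ≤ ℓ v
    2≤ℓ = proj₁ spec

    1≤ℓ₀ : 1 ≤ ℓ₀
    1≤ℓ₀ = ℕₚ.∸-monoˡ-≤ 1 2≤ℓ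

    suc-ℓ₀ : suc ℓ₀ ≡ ℓ v
    suc-ℓ₀ = ℕₚ.m+[n∸m]≡n (ℕₚ.≤-trans (s≤s z≤n) 2≤ℓ)

    2≤τ-end : 2 ≤ τ (s ℓ₀)
    2≤τ-end = proj₁ (proj₂ spec)

    τ-interior : ∀ k → 1 ≤ k → k < ℓ₀ → τ (s k) ≡ 1
    τ-interior k 1≤k k<ℓ₀ =
      ℕₚ.≤-antisym (ℕₚ.≤-pred (proj₂ (proj₂ spec) (suc k) (s≤s 1≤k) k+1<ℓ)) (1≤τ (s k))
      where
      k+1<ℓ : suc k < ℓ v
      k+1<ℓ = subst (suc (suc k) ≤_) suc-ℓ₀ (s≤s k<ℓ₀)

    TauHead-interior : ∀ k → 1 ≤ k → k < ℓ₀ → TauHead (drop k (mn v)) 1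
    TauHead-interior k 1≤k k<ℓ₀ = subst (TauHead (drop k (mn v))) (τ-interior k 1≤k k<ℓ₀) (TauHead-suffix o k)

    suffix-step : ∀ k → 1 ≤ k → k < ℓ₀ → drop (suc k) (mn v) <ₗ drop k (mn v)
    suffix-step k 1≤k k<ℓ₀ =
      <ₗ-respʳ-≈ (<ₗ-respˡ-≈ tail≈ (subst (TauIs (mn (s k))) (τ-interior k 1≤k k<ℓ₀) (τSpec (s k))))
                 (min-suffix o k)
      where
      tail≈ : tail (mn (s k)) ≈S drop (suc k) (mn v)
      tail≈ i = trans (min-suffix o k (suc i)) (cong (mn v) (sym (ℕₚ.+-suc i k)))

    suffix-< : ∀ {i j} → 1 ≤ j → j ≤ i → i < ℓ₀ → drop (suc i) (mn v) <ₗ drop j (mn v)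
    suffix-< {zero} 1≤j j≤0 _ = ⊥-elim (ℕₚ.<⇒≱ 1≤j j≤0)
    suffix-< {suc i} 1≤j j≤i i<ℓ₀ with ℕₚ.m≤n⇒m<n∨m≡n j≤i
    ... | inj₁ j<i =
      <ₗ-trans (suffix-step (suc i) (s≤s z≤n) i<ℓ₀) (suffix-< 1≤j (ℕₚ.≤-pred j<i) (ℕₚ.<-trans ℕₚ.≤-refl i<ℓ₀))
    ... | inj₂ refl = suffix-step (suc i) (s≤s z≤n) i<ℓ₀

    -- layer i = G_{i+1}(v) and visited i = G_2(v) ∪ … ∪ G_{i+1}(v)
    layer visited : ℕ → Fin n → Set
    layer i = proj₁ (Gstep G τ v i)
    visited i = proj₂ (Gstep G τ v i)

    Reach : ℕ → Fin n → Set
    Reach j w = Path v (mn v) j w × lab w ≡ mn v j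

    record Invariant (i : ℕ) : Set where
      field
        on-layer : layer i (s i)
        layer-reached : ∀ {w} → layer i w → Reach i w
        visited-reached : ∀ {w} → visited i w → ∃[ j ] (1 ≤ j × j ≤ i × Reach j w)

    invariant-zero : Invariant 0
    invariant-zero = record
      { on-layer = proj₁ o
      ; layer-reached = λ { refl → [] , lab≡min-head v }
      ; visited-reached = λ ()
      }

    module _ {i : ℕ} (i<ℓ₀ : i < ℓ₀) (inv : Invariant i) where
      open Invariant inv

      predecessor-≤ₗ : ∀ {w} → Pred G τ (layer i) w → drop (suc i) (mn v) ≤ₗ mn w
      predecessor-≤ₗ (w₀ , w₀∈ , edge) with layer-reached w₀∈
      ... | p , label = Path-min-≤ₗ (Path-snoc p label edge)

      lab-minimal : ∀ {w} → Pred G τ (layer i) w → lab (s (suc i)) F.≤ lab w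
      lab-minimal {w} w∈ with ≤ₗ-head (predecessor-≤ₗ w∈)
      ... | inj₁ lt = ℕₚ.<⇒≤ (subst₂ F._<_ (sym (proj₂ (proj₂ o) (suc i))) (sym (lab≡min-head w)) lt)
      ... | inj₂ eq = Fₚ.≤-reflexive (trans (proj₂ (proj₂ o) (suc i)) (trans eq (sym (lab≡min-head w))))

      τ-minimal : ∀ {w} → Pred G τ (layer i) w → lab w ≡ lab (s (suc i)) → τ (s (suc i)) ≤ τ w
      τ-minimal {w} w∈ lab≡ with ℕₚ.m≤n⇒m<n∨m≡n i<ℓ₀
      ... | inj₁ suc-i<ℓ₀ = subst (_≤ τ w) (sym (τ-interior (suc i) (s≤s z≤n) suc-i<ℓ₀)) (1≤τ w)
      ... | inj₂ suc-i≡ℓ₀ =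
        TauHead-mono _ _ (predecessor-≤ₗ w∈) heads (subst (λ k → 2 ≤ τ (s k)) (sym suc-i≡ℓ₀) 2≤τ-end)
                     (TauHead-suffix o (suc i)) (TauHead-min w)
        where
        heads : mn v (suc i) ≡ mn w 0
        heads = trans (sym (proj₂ (proj₂ o) (suc i))) (trans (sym lab≡) (lab≡min-head w))

      not-visited : ¬ visited i (s (suc i))
      not-visited s∈ with visited-reached s∈
      ... | j , 1≤j , j≤i , p , _ =
        <ₗ-irrefl′ (<-≤ₗ-trans (suffix-< 1≤j j≤i i<ℓ₀)
                               (≤ₗ-respʳ-≈ (Path-min-≤ₗ p) (min-suffix o (suc i))))

      invariant-suc : Invariant (suc i)
      invariant-suc = record
        { on-layer = ((predecessor , (λ w → lab-minimal) , (λ w → τ-minimal)) , not-visited)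
        ; layer-reached = reached
        ; visited-reached = λ { (inj₁ w∈) → weaken (visited-reached w∈)
                              ; (inj₂ w∈) → suc i , s≤s z≤n , ℕₚ.≤-refl , reached w∈ }
        }
        where
        predecessor : Pred G τ (layer i) (s (suc i))
        predecessor = s i , on-layer , proj₁ (proj₂ o) i
        reached : ∀ {w} → layer (suc i) w → Reach (suc i) w
        reached {w} (((w₀ , w₀∈ , edge) , lab-min , _) , _) with layer-reached w₀∈
        ... | p , label =
          Path-snoc p label edge ,
          trans (Fₚ.≤-antisym (lab-min (s (suc i)) predecessor) (lab-minimal (w₀ , w₀∈ , edge)))
                (proj₂ (proj₂ o) (suc i))
        weaken : ∀ {w} → ∃[ j ] (1 ≤ j × j ≤ i × Reach j w) → ∃[ j ] (1 ≤ j × j ≤ suc i × Reach j w)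
        weaken (j , 1≤j , j≤i , r) = j , 1≤j , ℕₚ.m≤n⇒m≤1+n j≤i , r

    invariant : ∀ i → i ≤ ℓ₀ → Invariant i
    invariant zero _ = invariant-zero
    invariant (suc i) i<ℓ₀ = invariant-suc i<ℓ₀ (invariant i (ℕₚ.<⇒≤ i<ℓ₀))

    end∈G : Gset G τ (ℓ v) v (s ℓ₀)
    end∈G = subst (λ l → Gset G τ l v (s ℓ₀)) suc-ℓ₀ (Invariant.on-layer (invariant ℓ₀ ℕₚ.≤-refl))

    G-end-reached : ∀ {w} → Gset G τ (ℓ v) v w → Reach ℓ₀ w
    G-end-reached {w} w∈ =
      Invariant.layer-reached (invariant ℓ₀ ℕₚ.≤-refl) (subst (λ l → Gset G τ l v w) (sym suc-ℓ₀) w∈)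

    τ-end≡tt : τ (s ℓ₀) ≡ tt v
    τ-end≡tt = proj₂ (ttSpec v τv≡3) (s ℓ₀) end∈G

    2≤tt : 2 ≤ tt v
    2≤tt = subst (2 ≤_) τ-end≡tt 2≤τ-end

    tt-range : tt v ≡ 2 ⊎ tt v ≡ 3
    tt-range = proj₁ (ttSpec v τv≡3)

    TauHead-end : TauHead (drop ℓ₀ (mn v)) (tt v)
    TauHead-end = subst (TauHead (drop ℓ₀ (mn v))) τ-end≡tt (TauHead-suffix o ℓ₀)

  SameBlock : Fin n → Fin n → Set
  SameBlock x y = ℓ x ≡ ℓ y × tt x ≡ tt y × (∀ d → d < ℓ x → mn x d ≡ mn y d)

  SameBlock⇒labBar≡ : ∀ {x y} → SameBlock x y → labBar x ≡ labBar y
  SameBlock⇒labBar≡ {x} {y} (ℓ≡ , tt≡ , agree) =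
    cong₂ _,_ (trans (applyUpTo-cong (mn x) (mn y) (ℓ x) agree) (cong (applyUpTo (mn y)) ℓ≡)) tt≡

  ℓ<⇒end-≰ : ∀ {x y} → τ x ≡ 3 → τ y ≡ 3 → ℓ x < ℓ y → let r = ℓ x ∸ 1 in
       mn x r ≡ mn y r → ¬ drop r (mn x) ≤ₗ drop r (mn y)
  ℓ<⇒end-≰ {x} {y} τx≡3 τy≡3 ℓx<ℓy heads x≤y =
    ℕₚ.<⇒≱ X.2≤tt
      (TauHead-mono (tt x) 1 x≤y heads X.2≤tt X.TauHead-end (Y.TauHead-interior X.ℓ₀ X.1≤ℓ₀ ℓ₀<))
    where
    module X = Block τx≡3 (proj₂ (min-occ x))
    module Y = Block τy≡3 (proj₂ (min-occ y))
    ℓ₀< : X.ℓ₀ < Y.ℓ₀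
    ℓ₀< = ℕₚ.∸-monoˡ-< ℓx<ℓy (ℕₚ.≤-trans (s≤s z≤n) X.2≤ℓ)

  module Compare {x y : Fin n} (τx≡3 : τ x ≡ 3) (τy≡3 : τ y ≡ 3) where
    private
      module X = Block τx≡3 (proj₂ (min-occ x))
      module Y = Block τy≡3 (proj₂ (min-occ y))

    Y-end-at-X : ℓ x ≡ ℓ y → TauHead (drop X.ℓ₀ (mn y)) (tt y)
    Y-end-at-X ℓ≡ = subst (λ l → TauHead (drop (l ∸ 1) (mn y)) (tt y)) (sym ℓ≡) Y.TauHead-end

    compare-≈ : mn x ≈S mn y → SameBlock x y
    compare-≈ x≈y = ℓ≡ , tt≡ , (λ d _ → x≈y d)
      where
      ℓ≡ : ℓ x ≡ ℓ y
      ℓ≡ with ℕₚ.<-cmp (ℓ x) (ℓ y)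
      ... | tri< ℓx<ℓy _ _ = ⊥-elim (ℓ<⇒end-≰ τx≡3 τy≡3 ℓx<ℓy (x≈y X.ℓ₀) (inj₂ (λ i → x≈y (i + X.ℓ₀))))
      ... | tri≈ _ ℓx≡ℓy _ = ℓx≡ℓy
      ... | tri> _ _ ℓy<ℓx =
        ⊥-elim (ℓ<⇒end-≰ τy≡3 τx≡3 ℓy<ℓx (sym (x≈y Y.ℓ₀)) (inj₂ (λ i → sym (x≈y (i + Y.ℓ₀)))))
      tt≡ : tt x ≡ tt y
      tt≡ = TauHead-functional _ _ X.TauHead-end
              (TauHead-resp-≈ _ (λ i → sym (x≈y (i + X.ℓ₀))) (Y-end-at-X ℓ≡))

    γ-differ : ∀ {P} → P < ℓ x → P < ℓ y → (∀ d → d < P → mn x d ≡ mn y d) → mn x P F.< mn y P →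
               labBar x <' labBar y
    γ-differ P<ℓx P<ℓy agree lt with applyUpTo-<L (mn x) (mn y) P<ℓx P<ℓy agree lt
    ... | γ< , ¬prefix = (λ eq → ¬prefix ([] , trans (Listₚ.++-identityʳ _) (cong proj₁ eq))) , inj₁ (¬prefix , γ<)

    γ-strict-prefix : ℓ y < ℓ x → (∀ d → d < ℓ y → mn x d ≡ mn y d) → labBar x <' labBar y
    γ-strict-prefix ℓy<ℓx agree =
      (λ eq → ℕₚ.<⇒≢ ℓy<ℓx (sym (applyUpTo-injectiveˡ (mn x) (mn y) (cong proj₁ eq)))) ,
      inj₂ (inj₂ (applyUpTo-strict-prefix (mn x) (mn y) ℓy<ℓx agree))

    same-ℓ : ℓ x ≡ ℓ y → (∀ d → d ≤ X.ℓ₀ → mn x d ≡ mn y d) →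
             drop X.ℓ₀ (mn x) <ₗ drop X.ℓ₀ (mn y) → labBar x <' labBar y ⊎ SameBlock x y
    same-ℓ ℓ≡ agree lt = by-tt X.tt-range Y.tt-range
      where
      agree-γ : ∀ d → d < ℓ x → mn x d ≡ mn y d
      agree-γ d d<ℓx = agree d (ℕₚ.≤-pred (subst (d <_) (sym X.suc-ℓ₀) d<ℓx))
      γ≡ : γ x ≡ γ y
      γ≡ = trans (applyUpTo-cong (mn x) (mn y) (ℓ x) agree-γ) (cong (applyUpTo (mn y)) ℓ≡)
      x-end : ∀ {t} → tt x ≡ t → TauHead (drop X.ℓ₀ (mn x)) t
      x-end eq = subst (TauHead _) eq X.TauHead-end
      y-end : ∀ {t} → tt y ≡ t → TauHead (drop X.ℓ₀ (mn y)) t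
      y-end eq = subst (TauHead _) eq (Y-end-at-X ℓ≡)
      heads : mn x X.ℓ₀ ≡ mn y X.ℓ₀
      heads = agree X.ℓ₀ ℕₚ.≤-refl
      by-tt : tt x ≡ 2 ⊎ tt x ≡ 3 → tt y ≡ 2 ⊎ tt y ≡ 3 → labBar x <' labBar y ⊎ SameBlock x y
      by-tt (inj₁ ttx≡2) (inj₁ tty≡2) =
        ⊥-elim (<ₗ-irrefl (TauHead-2-≈ heads (x-end ttx≡2) (y-end tty≡2)) lt)
      by-tt (inj₁ ttx≡2) (inj₂ tty≡3) =
        inj₁ ((λ eq → ℕₚ.<⇒≢ ℕₚ.≤-refl (trans (sym ttx≡2) (trans (cong proj₂ eq) tty≡3))) ,
              inj₂ (inj₁ (γ≡ , ttx≡2 , tty≡3)))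
      by-tt (inj₂ ttx≡3) (inj₁ tty≡2) =
        ⊥-elim (ℕₚ.<⇒≱ ℕₚ.≤-refl (TauHead-mono 3 2 (inj₁ lt) heads (s≤s (s≤s z≤n)) (x-end ttx≡3) (y-end tty≡2)))
      by-tt (inj₂ ttx≡3) (inj₂ tty≡3) = inj₂ (ℓ≡ , trans ttx≡3 (sym tty≡3) , agree-γ)

    compare-< : mn x <ₗ mn y → labBar x <' labBar y ⊎ SameBlock x y
    compare-< x<y@(P , agree , lt) with P <? ℓ x | P <? ℓ y
    ... | yes P<ℓx | yes P<ℓy = inj₁ (γ-differ P<ℓx P<ℓy agree lt)
    ... | yes P<ℓx | no P≮ℓy =
      inj₁ (γ-strict-prefix (ℕₚ.≤-<-trans (ℕₚ.≮⇒≥ P≮ℓy) P<ℓx)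
                            (λ d d<ℓy → agree d (ℕₚ.<-≤-trans d<ℓy (ℕₚ.≮⇒≥ P≮ℓy))))
    ... | no P≮ℓx | _ = beyond-x (ℕₚ.≮⇒≥ P≮ℓx)
      where
      beyond-x : ℓ x ≤ P → labBar x <' labBar y ⊎ SameBlock x y
      beyond-x ℓx≤P = by-ℓ (ℕₚ.<-cmp (ℓ x) (ℓ y))
        where
        ℓ₀<P : X.ℓ₀ < P
        ℓ₀<P = ℕₚ.<-≤-trans (subst (X.ℓ₀ <_) X.suc-ℓ₀ ℕₚ.≤-refl) ℓx≤P
        drop< : drop X.ℓ₀ (mn x) <ₗ drop X.ℓ₀ (mn y)
        drop< = drop-<ₗ X.ℓ₀ (λ i i<ℓ₀ → agree i (ℕₚ.<-trans i<ℓ₀ ℓ₀<P)) x<y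
        by-ℓ : Tri (ℓ x < ℓ y) (ℓ x ≡ ℓ y) (ℓ y < ℓ x) → labBar x <' labBar y ⊎ SameBlock x y
        by-ℓ (tri< ℓx<ℓy _ _) = ⊥-elim (ℓ<⇒end-≰ τx≡3 τy≡3 ℓx<ℓy (agree X.ℓ₀ ℓ₀<P) (inj₁ drop<))
        by-ℓ (tri≈ _ ℓ≡ _) = same-ℓ ℓ≡ (λ d d≤ℓ₀ → agree d (ℕₚ.≤-<-trans d≤ℓ₀ ℓ₀<P)) drop<
        by-ℓ (tri> _ _ ℓy<ℓx) =
          inj₁ (γ-strict-prefix ℓy<ℓx λ d d<ℓy → agree d (ℕₚ.<-trans d<ℓy (ℕₚ.<-≤-trans ℓy<ℓx ℓx≤P)))

    compare : mn x ≤ₗ mn y → labBar x <' labBar y ⊎ SameBlock x y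
    compare (inj₁ x<y) = compare-< x<y
    compare (inj₂ x≈y) = inj₂ (compare-≈ x≈y)

module Compression {σ n : ℕ} {G : Graph σ n} (Q : Quantities G) {u : Fin n} (τu≡3 : Quantities.τ Q u ≡ 3)
                   {s : Stream (Fin n)} (o : Occ (Graph.Edge G) (Graph.lab G) u s (Quantities.mn Q u)) where
  open Graph G
  open Quantities Q
  open Derived Q
  open Minima G Q
  open Compressed Q s

  count-∈ : ∀ k → InL k → count (suc k) ≡ suc (count k)
  count-∈ k k∈L with τ (s k) ≟ 3
  ... | yes _ = refl
  ... | no k∉L = ⊥-elim (k∉L k∈L)

  count-∉ : ∀ k → ¬ InL k → count (suc k) ≡ count k
  count-∉ k k∉L with τ (s k) ≟ 3
  ... | yes k∈L = ⊥-elim (k∉L k∈L)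
  ... | no _ = refl

  count-≤-suc : ∀ k → count k ≤ count (suc k)
  count-≤-suc k with τ (s k) ≟ 3
  ... | yes _ = ℕₚ.n≤1+n (count k)
  ... | no _ = ℕₚ.≤-refl

  count-mono : ∀ d k → count k ≤ count (d + k)
  count-mono zero k = ℕₚ.≤-refl
  count-mono (suc d) k = ℕₚ.≤-trans (count-mono d k) (count-≤-suc (d + k))

  count-gap : ∀ {m p} → IsJ m p → ∀ d → (∀ e → 1 ≤ e → e ≤ d → ¬ InL (e + p)) →
              count (suc d + p) ≡ suc m
  count-gap (p∈L , count≡m) zero _ = trans (count-∈ _ p∈L) (cong suc count≡m)
  count-gap J (suc d) gap =
    trans (count-∉ (suc d + _) (gap (suc d) (s≤s z≤n) ℕₚ.≤-refl))
          (count-gap J d (λ e 1≤e e≤d → gap e 1≤e (ℕₚ.m≤n⇒m≤1+n e≤d)))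

  IsJ-zero : IsJ 0 0
  IsJ-zero = subst (λ v → τ v ≡ 3) (sym (proj₁ o)) τu≡3 , refl

  module AtJ {m p : ℕ} (J : IsJ m p) where
    module B = Block (proj₁ J) (min-occ-suffix o p)

    ∉L-interior : ∀ e → 1 ≤ e → e < B.ℓ₀ → ¬ InL (e + p)
    ∉L-interior e 1≤e e<ℓ₀ e∈L = ℕₚ.<⇒≢ (s≤s (s≤s z≤n)) (trans (sym (B.τ-interior e 1≤e e<ℓ₀)) e∈L)

    IsJ-next : tt (s p) ≡ 3 → IsJ (suc m) (B.ℓ₀ + p)
    IsJ-next tt≡3 =
      trans B.τ-end≡tt tt≡3 ,
      trans (cong (λ k → count (k + p)) (sym suc-pred))
            (count-gap J (B.ℓ₀ ∸ 1) λ e 1≤e e≤ → ∉L-interior e 1≤e (ℕₚ.<-≤-trans (s≤s e≤) (ℕₚ.≤-reflexive suc-pred)))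
      where
      suc-pred : suc (B.ℓ₀ ∸ 1) ≡ B.ℓ₀
      suc-pred = ℕₚ.m+[n∸m]≡n B.1≤ℓ₀

    ∉L-after : tt (s p) ≡ 2 → ∀ e → 1 ≤ e → ¬ InL (e + p)
    ∉L-after tt≡2 e 1≤e with e <? B.ℓ₀
    ... | yes e<ℓ₀ = ∉L-interior e 1≤e e<ℓ₀
    ... | no e≮ℓ₀ = λ e∈L → ℕₚ.<⇒≢ ℕₚ.≤-refl (trans (sym τ≡2) e∈L)
      where
      τ≡2 : τ (s (e + p)) ≡ 2
      τ≡2 = TauHead-functional _ 2 (TauHead-suffix (min-occ-suffix o p) e)
              (TauHead-2-drop {α = mn (s p)} (subst (TauHead _) tt≡2 B.TauHead-end) (ℕₚ.≮⇒≥ e≮ℓ₀))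

    no-j-after : tt (s p) ≡ 2 → ∀ i → m < i → ¬ (∃[ k ] IsJ i k)
    no-j-after tt≡2 i m<i (k , k∈L , count≡i) with k ≤? p
    ... | yes k≤p =
      ℕₚ.<⇒≱ m<i (subst₂ _≤_ count≡i (proj₂ J)
                   (subst (λ q → count k ≤ count q) (ℕₚ.m∸n+n≡m k≤p) (count-mono (p ∸ k) k)))
    ... | no k≰p = ∉L-after tt≡2 (k ∸ p) (ℕₚ.m<n⇒0<n∸m (ℕₚ.≰⇒> k≰p))
                   (subst InL (sym (ℕₚ.m∸n+n≡m (ℕₚ.<⇒≤ (ℕₚ.≰⇒> k≰p)))) k∈L)

  module Sequence {u′ : Stream (Fin n)} (ps : PrimeSpec u′) where

    u′-at-j : ∀ {i k} → IsJ i k → u′ i ≡ s k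
    u′-at-j {i} {k} = proj₁ ps i k

    u′-stays : ∀ {m p} → IsJ m p → tt (s p) ≡ 2 → ∀ i → m ≤ i → u′ i ≡ s p
    u′-stays {m} {p} J tt≡2 i m≤i with ℕₚ.m≤n⇒m<n∨m≡n m≤i
    ... | inj₂ refl = u′-at-j J
    ... | inj₁ m<i =
      trans (proj₂ ps i (AtJ.no-j-after J tt≡2 i m<i) m (p , J) (AtJ.no-j-after J tt≡2 (suc m) ℕₚ.≤-refl))
            (u′-at-j J)

    Constant : ℕ → Set
    Constant i = ∃[ p ] ((∀ i′ → i ≤ i′ → u′ i′ ≡ s p) × τ (s p) ≡ 3 × tt (s p) ≡ 2)

    j-or-constant : ∀ i → (∃[ p ] IsJ i p) ⊎ Constant i
    forward-or-constant : ∀ i → (∃[ p ] (IsJ i p × tt (s p) ≡ 3)) ⊎ Constant i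

    j-or-constant zero = inj₁ (0 , IsJ-zero)
    j-or-constant (suc i) with forward-or-constant i
    ... | inj₁ (p , J , tt≡3) = inj₁ (_ , AtJ.IsJ-next J tt≡3)
    ... | inj₂ (p , stays , τ≡3 , tt≡2) = inj₂ (p , (λ i′ i<i′ → stays i′ (ℕₚ.<⇒≤ i<i′)) , τ≡3 , tt≡2)

    forward-or-constant i with j-or-constant i
    ... | inj₂ constant = inj₂ constant
    ... | inj₁ (p , J) with AtJ.B.tt-range J
    ...   | inj₁ tt≡2 = inj₂ (p , u′-stays J tt≡2 , proj₁ J , tt≡2)
    ...   | inj₂ tt≡3 = inj₁ (p , J , tt≡3)

    u′-edge : ∀ i → EdgeBar (u′ (suc i)) (u′ i)
    u′-edge i with forward-or-constant i
    ... | inj₂ (p , stays , τ≡3 , tt≡2) = loop (stays (suc i) (ℕₚ.n≤1+n i)) (stays i ℕₚ.≤-refl)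
      where
      loop : ∀ {a b} → a ≡ s p → b ≡ s p → EdgeBar a b
      loop refl refl = inj₁ (τ≡3 , tt≡2 , refl)
    ... | inj₁ (p , J , tt≡3) = forward (u′-at-j J′) (u′-at-j J) (proj₁ J′) (AtJ.B.end∈G J)
      where
      J′ = AtJ.IsJ-next J tt≡3
      forward : ∀ {a b c} → a ≡ c → b ≡ s p → τ c ≡ 3 → Gset G τ (ℓ (s p)) (s p) c → EdgeBar a b
      forward refl refl τc≡3 c∈G = inj₂ (proj₁ J , tt≡3 , τc≡3 , c∈G)

    u′-occ : Occ EdgeBar labBar u u′ (labBar ∘ u′)
    u′-occ = trans (u′-at-j IsJ-zero) (proj₁ o) , u′-edge , (λ _ → refl)

    AllEqual : Stream (Fin n) → Set
    AllEqual w = ∀ j → labBar (u′ j) ≡ labBar (w j)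

    module Minimality {w : Stream (Fin n)} (w₀ : w 0 ≡ u) (w-edge : ∀ i → EdgeBar (w (suc i)) (w i)) where

      τw≡3 : ∀ i → τ (w i) ≡ 3
      τw≡3 i with w-edge i
      ... | inj₁ (τ≡3 , _) = τ≡3
      ... | inj₂ (τ≡3 , _) = τ≡3

      w-loop : ∀ i → tt (w i) ≡ 2 → w (suc i) ≡ w i
      w-loop i tt≡2 with w-edge i
      ... | inj₁ (_ , _ , eq) = eq
      ... | inj₂ (_ , tt≡3 , _) = ⊥-elim (ℕₚ.<⇒≢ ℕₚ.≤-refl (trans (sym tt≡2) tt≡3))

      w-constant : ∀ i → tt (w i) ≡ 2 → ∀ j → i ≤ j → w j ≡ w i
      w-constant i tt≡2 j i≤j = trans (cong w (sym (ℕₚ.m∸n+n≡m i≤j))) (from-i (j ∸ i))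
        where
        from-i : ∀ d → w (d + i) ≡ w i
        from-i zero = refl
        from-i (suc d) = trans (w-loop (d + i) (trans (cong tt (from-i d)) tt≡2)) (from-i d)

      w-forward : ∀ i → tt (w i) ≡ 3 → Gset G τ (ℓ (w i)) (w i) (w (suc i))
      w-forward i tt≡3 with w-edge i
      ... | inj₁ (_ , tt≡2 , _) = ⊥-elim (ℕₚ.<⇒≢ ℕₚ.≤-refl (trans (sym tt≡2) tt≡3))
      ... | inj₂ (_ , _ , _ , w′∈G) = w′∈G

      module W (i : ℕ) = Block (τw≡3 i) (proj₂ (min-occ (w i)))

      Finite : ℕ → Set
      Finite i = tt (w i) ≡ 3

      len : ℕ → ℕ
      len i = ℓ (w i) ∸ 1

      reach : ∀ i → Finite i → W.Reach i (len i) (w (suc i))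
      reach i fin = W.G-end-reached i (w-forward i fin)

      block : ∀ i → Dec (Finite i) → Stream (Fin n)
      block i (yes fin) = nodes (proj₁ (reach i fin))
      block i (no _) = proj₁ (min-occ (w i))

      blk : ℕ → Stream (Fin n)
      blk i = block i (tt (w i) ≟ 3)

      blk-start : ∀ i → blk i 0 ≡ w i
      blk-start i = by (tt (w i) ≟ 3)
        where
        by : ∀ c → block i c 0 ≡ w i
        by (yes fin) = nodes-start (proj₁ (reach i fin))
        by (no _) = proj₁ (proj₂ (min-occ (w i)))

      blk-end : ∀ i → Finite i → blk i (len i) ≡ w (suc i)
      blk-end i fin = by (tt (w i) ≟ 3)
        where
        by : ∀ c → block i c (len i) ≡ w (suc i)
        by (yes fin′) = nodes-end (proj₁ (reach i fin′))
        by (no ¬fin) = ⊥-elim (¬fin fin)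

      blk-edge : ∀ i k → (Finite i → k < len i) → Edge (blk i (suc k)) (blk i k)
      blk-edge i k inside = by (tt (w i) ≟ 3)
        where
        by : ∀ c → Edge (block i c (suc k)) (block i c k)
        by (yes fin) = nodes-edge (proj₁ (reach i fin)) k (inside fin)
        by (no _) = proj₁ (proj₂ (proj₂ (min-occ (w i)))) k

      blk-label : ∀ i → Finite i → ∀ d → d ≤ len i → lab (blk i d) ≡ mn (w i) d
      blk-label i fin d d≤len = by (tt (w i) ≟ 3)
        where
        by : ∀ c → lab (block i c d) ≡ mn (w i) d
        by (no ¬fin) = ⊥-elim (¬fin fin)
        by (yes fin′) with reach i fin′ | ℕₚ.m≤n⇒m<n∨m≡n d≤len
        ... | p , _ | inj₁ d<len = nodes-label p d d<len
        ... | p , label | inj₂ refl = trans (cong lab (nodes-end p)) label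

      open Concatenation Edge blk len (λ i → tt (w i) ≟ 3) (λ i _ → W.1≤ℓ₀ i) blk-edge
                         (λ i fin → trans (blk-start (suc i)) (sym (blk-end i fin)))

      β : Stream (Fin σ)
      β = lab ∘ concat

      concat-occ : Occ Edge lab u concat β
      concat-occ = trans (blk-start 0) w₀ , concat-edge , (λ _ → refl)

      concat-start : ∀ i → AllFinite i → concat (start i) ≡ w i
      concat-start i finite = trans (concat-block i finite 0 (λ _ → z≤n)) (blk-start i)

      β-block : ∀ i → AllFinite i → Finite i → ∀ d → d ≤ len i → β (d + start i) ≡ mn (w i) d
      β-block i finite fin d d≤len = trans (cong lab (concat-block i finite d (λ _ → d≤len))) (blk-label i fin d d≤len)

      record Synced (i : ℕ) : Set where
        field
          finite : AllFinite i
          j-at-start : IsJ i (start i)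
          α≡β : ∀ k → k < start i → mn u k ≡ β k
          labels≡ : ∀ j → j < i → labBar (u′ j) ≡ labBar (w j)

      synced-zero : Synced 0
      synced-zero = record { finite = λ _ (); j-at-start = IsJ-zero; α≡β = λ _ (); labels≡ = λ _ () }

      SmallerAt : ℕ → Set
      SmallerAt i = (∀ j → j < i → labBar (u′ j) ≡ labBar (w j)) × labBar (u′ i) <' labBar (w i)

      module _ {i : ℕ} (sync : Synced i) where
        open Synced sync

        private
          P = start i
          x = s P

        ≤-block : mn x ≤ₗ mn (w i)
        ≤-block =
          ≤ₗ-respˡ-≈ (≈S-sym (min-suffix o P))
            (subst (λ v → drop P (mn u) ≤ₗ mn v) (concat-start i finite)
              (Path-min-≤ₗ (Path-resp (λ k k<P → sym (α≡β k k<P)) (occ⇒Path concat-occ P))))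

        ≥-block : mn u ≈S β → mn (w i) ≤ₗ mn x
        ≥-block α≈β =
          ≤ₗ-respʳ-≈ (subst (λ v → mn v ≤ₗ drop P β) (concat-start i finite) (min-≤ₗ (occ-drop concat-occ P)))
                     (λ k → trans (sym (α≈β (k + P))) (sym (min-suffix o P k)))

        same-2 : SameBlock x (w i) → tt (w i) ≡ 2 → AllEqual w
        same-2 same@(_ , tt≡ , _) tt≡2 j with j <? i
        ... | yes j<i = labels≡ j j<i
        ... | no j≮i =
          begin
            labBar (u′ j) ≡⟨ cong labBar (u′-stays j-at-start (trans tt≡ tt≡2) j (ℕₚ.≮⇒≥ j≮i)) ⟩
            labBar x      ≡⟨ SameBlock⇒labBar≡ same ⟩
            labBar (w i)  ≡⟨ cong labBar (w-constant i tt≡2 j (ℕₚ.≮⇒≥ j≮i)) ⟨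
            labBar (w j)  ∎
          where open ≡-Reasoning

        same-3 : SameBlock x (w i) → Finite i → Synced (suc i)
        same-3 same@(ℓ≡ , tt≡ , agree) fin = record
          { finite = λ j j≤i → [ finite j , (λ { refl → fin }) ]′ (ℕₚ.m≤n⇒m<n∨m≡n (ℕₚ.≤-pred j≤i))
          ; j-at-start = subst (λ l → IsJ (suc i) ((l ∸ 1) + P)) ℓ≡ (AtJ.IsJ-next j-at-start (trans tt≡ fin))
          ; α≡β = α≡β′
          ; labels≡ = λ j j≤i → [ labels≡ j , (λ { refl → labBar≡ }) ]′ (ℕₚ.m≤n⇒m<n∨m≡n (ℕₚ.≤-pred j≤i))
          }
          where
          labBar≡ : labBar (u′ i) ≡ labBar (w i)
          labBar≡ = trans (cong labBar (u′-at-j j-at-start)) (SameBlock⇒labBar≡ same)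
          α≡β′ : ∀ k → k < len i + P → mn u k ≡ β k
          α≡β′ k k< with k <? P
          ... | yes k<P = α≡β k k<P
          ... | no k≮P =
            begin
              mn u k            ≡⟨ cong (mn u) (sym d+P≡k) ⟩
              mn u (d + P)      ≡⟨ min-suffix o P d ⟨
              mn x d            ≡⟨ agree d (ℕₚ.<-≤-trans d<len len≤ℓx) ⟩
              mn (w i) d        ≡⟨ β-block i finite fin d (ℕₚ.<⇒≤ d<len) ⟨
              β (d + P)         ≡⟨ cong β d+P≡k ⟩
              β k               ∎
            where
            open ≡-Reasoning
            d = k ∸ P
            d+P≡k : d + P ≡ k
            d+P≡k = ℕₚ.m∸n+n≡m (ℕₚ.≮⇒≥ k≮P)
            len≤ℓx : len i ≤ ℓ x
            len≤ℓx = subst (len i ≤_) (sym ℓ≡) (ℕₚ.m∸n≤m (ℓ (w i)) 1)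
            d<len : d < len i
            d<len = ℕₚ.+-cancelʳ-< P d (len i) (subst (_< len i + P) (sym d+P≡k) k<)

        after-same : SameBlock x (w i) → AllEqual w ⊎ Synced (suc i)
        after-same same with W.tt-range i
        ... | inj₁ tt≡2 = inj₁ (same-2 same tt≡2)
        ... | inj₂ tt≡3 = inj₂ (same-3 same tt≡3)

        advance : SmallerAt i ⊎ AllEqual w ⊎ Synced (suc i)
        advance with Compare.compare (proj₁ j-at-start) (τw≡3 i) ≤-block
        ... | inj₁ smaller = inj₁ (labels≡ , subst (λ v → labBar v <' labBar (w i)) (sym (u′-at-j j-at-start)) smaller)
        ... | inj₂ same = inj₂ (after-same same)

        advance-≈ : mn u ≈S β → AllEqual w ⊎ Synced (suc i)
        advance-≈ α≈β =
          after-same (Compare.compare-≈ (proj₁ j-at-start) (τw≡3 i) (≤ₗ-antisym ≤-block (≥-block α≈β)))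

      -- Synced i makes min_u and β agree below start i, which grows with i;
      -- so the first difference K of min_u and β is reached within K + 1 steps.
      search : ∀ K → mn u K F.< β K → ∀ fuel i → Synced i → K < fuel + start i →
               LexLe _<'_ (labBar ∘ u′) (labBar ∘ w)
      search K α<β zero i sync K<start = ⊥-elim (Fₚ.<-irrefl (Synced.α≡β sync K K<start) α<β)
      search K α<β (suc fuel) i sync K< with advance sync
      ... | inj₁ (before , smaller) = inj₁ (i , before , smaller)
      ... | inj₂ (inj₁ all-equal) = inj₂ all-equal
      ... | inj₂ (inj₂ sync′) = search K α<β fuel (suc i) sync′ (ℕₚ.<-≤-trans K< fuel+start≤)
        where
        fuel+start≤ : suc fuel + start i ≤ fuel + start (suc i)
        fuel+start≤ = subst (_≤ fuel + start (suc i)) (ℕₚ.+-suc fuel (start i))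
                            (ℕₚ.+-monoʳ-≤ fuel (start-< i (Synced.finite sync′ i ℕₚ.≤-refl)))

      synced-forever : mn u ≈S β → ∀ i → AllEqual w ⊎ Synced i
      synced-forever α≈β zero = inj₂ synced-zero
      synced-forever α≈β (suc i) with synced-forever α≈β i
      ... | inj₁ all-equal = inj₁ all-equal
      ... | inj₂ sync = advance-≈ sync α≈β

      u′-≤ : LexLe _<'_ (labBar ∘ u′) (labBar ∘ w)
      u′-≤ with min-≤ₗ concat-occ
      ... | inj₁ (K , _ , α<β) = search K α<β (suc K) 0 synced-zero (ℕₚ.m≤m+n (suc K) 0)
      ... | inj₂ α≈β = inj₂ λ j →
        [ (λ all-equal → all-equal j) , (λ sync → Synced.labels≡ sync j ℕₚ.≤-refl) ]′ (synced-forever α≈β (suc j))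

    u′-min : IsMin _<'_ EdgeBar labBar u (labBar ∘ u′)
    u′-min = (u′ , u′-occ) , λ _ _ (w₀ , w-edge , w-label) →
      Lex.≤ₗ-respʳ-≈ _<'_ (Minimality.u′-≤ w₀ w-edge) w-label

lemma20 : ∀ {σ n : ℕ} (G : Graph σ n) (Q : Quantities G)
            (u : Fin n) → Quantities.τ Q u ≡ 3 →
            (seq : Stream (Fin n)) →
            Occ (Graph.Edge G) (Graph.lab G) u seq (Quantities.mn Q u) →
            (u' : Stream (Fin n)) → Compressed.PrimeSpec Q seq u' →
            Occ (Derived.EdgeBar Q) (Derived.labBar Q) u u' (Derived.labBar Q ∘ u')
            × IsMin _<'_ (Derived.EdgeBar Q) (Derived.labBar Q) u (Derived.labBar Q ∘ u')
lemma20 G Q u τu≡3 seq occ u' ps = u′-occ , u′-min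
  where open Compression.Sequence Q τu≡3 occ ps
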